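{- Let $a$ be a positive integer, $\mathbf{c}\in\mathbb{Z}^a$ with $\sum_i c_i=0$, and $\mathbf{x}=\mathbf{c}+\mathbf{s}$ where $s_i=\frac{i}{a}-\frac{a-1}{2a}$. Then the length (number of nonzero parts) of the $a$-core $\mathbf{core}_a(\mathbf{c})$ is $$\ell(\mathbf{core}_a(\mathbf{c}))=-\frac{a-1}{2}+a\max_{0\le i\le a-1}x_i .$$
   Context: For $\mathbf{c}\in\mathbb{Z}^a$ with $\sum c_i=0$, $\mathbf{core}_a(\mathbf{c})$ is the unique partition $\lambda=(\lambda_1\ge\lambda_2\ge\cdots\ge0)$ with $$\{\lambda_j-j+\tfrac12 : j\ge1\}=\bigcup_{i=0}^{a-1}\{ma-i-\tfrac12 : m\in\mathbb{Z},\ m\le -c_i\};$$ this is a bijection onto the set of $a$-cores (partitions with no hook length equal to $a$). $\ell(\lambda)$ denotes the number of nonzero parts of $\lambda$. -}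

module Defs where

open import Data.Nat as ℕ using (ℕ; zero; suc; NonZero)
open import Data.Integer as ℤ using (ℤ; +_)
open import Data.Rational as ℚ using (ℚ; ½; _/_)
open import Data.Fin using (Fin; toℕ)
open import Data.Fin as Fin using ()
open import Data.List using (List; []; _∷_; length)
open import Data.List.Relation.Unary.All using (All)
open import Data.List.Relation.Unary.Linked using (Linked)
open import Data.Vec.Functional using (foldr)
open import Data.Product using (Σ; ∃; _×_)
open import Function.Bundles using (_⇔_)
open import Relation.Binary.PropositionalEquality using (_≡_)

record Partition : Set where
  constructor mkPartition
  field
    parts    : List ℕ
    positive : All (λ p → 1 ℕ.≤ p) parts
    decr     : Linked (λ p q → q ℕ.≤ p) parts
open Partition public

ℓ : Partition → ℕ
ℓ λp = length (parts λp)

-- λ_j for j ≥ 1 (1-indexed), with λ_j = 0 beyond the last part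
partAt : List ℕ → ℕ → ℕ
partAt []       _             = 0
partAt (p ∷ ps) zero          = 0      -- index 0 is unused (j ≥ 1)
partAt (p ∷ ps) (suc zero)    = p
partAt (p ∷ ps) (suc (suc j)) = partAt ps (suc j)

_⟨_⟩ : Partition → ℕ → ℕ
λp ⟨ j ⟩ = partAt (parts λp) j

sumℤ : ∀ {a} → (Fin a → ℤ) → ℤ
sumℤ c = foldr ℤ._+_ (+ 0) c

maxℚ : ∀ {a} → .{{NonZero a}} → (Fin a → ℚ) → ℚ
maxℚ {suc zero}    f = f Fin.zero
maxℚ {suc (suc n)} f = f Fin.zero ℚ.⊔ maxℚ {suc n} (λ i → f (Fin.suc i))

InBetaSet : Partition → ℚ → Set
InBetaSet λp h = Σ ℕ λ j → (1 ℕ.≤ j) ×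
  (h ≡ (((+ (λp ⟨ j ⟩)) ℤ.- (+ j)) / 1) ℚ.+ ½)

InCoreSet : (a : ℕ) → (Fin a → ℤ) → ℚ → Set
InCoreSet a c h = Σ (Fin a) λ i → Σ ℤ λ m → (m ℤ.≤ ℤ.- c i) ×
  (h ≡ (((m ℤ.* (+ a)) ℤ.- (+ toℕ i)) / 1) ℚ.- ½)

-- λ = core_a(c): the (unique) partition whose set {λ_j - j + 1/2} equals the above union
IsCore : (a : ℕ) → (Fin a → ℤ) → Partition → Set
IsCore a c λp = ∀ (h : ℚ) → InBetaSet λp h ⇔ InCoreSet a c h

sVec : (a : ℕ) → .{{NonZero a}} → Fin a → ℚ
sVec a i = ((+ toℕ i) / a) ℚ.- (½ ℚ.* ((+ (a ℕ.∸ 1)) / a))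

xVec : (a : ℕ) → .{{NonZero a}} → (Fin a → ℤ) → Fin a → ℚ
xVec a c i = ((c i) / 1) ℚ.+ sVec a i

module Submission where

-- Write a = k + 1 and eᵢ = a·cᵢ + i − k.  Unfolding sᵢ shows that
-- −(a−1)/2 + a·xᵢ = eᵢ, and y ↦ −(a−1)/2 + a·y is strictly increasing, so
-- the right-hand side equals maxᵢ eᵢ; the theorem is therefore the integer
-- statement  ℓ = maxᵢ eᵢ.
--
-- Shifting by ½, both sets in the definition of core_a(c) become sets of
-- integers: the beta set B = {λⱼ − j} of λ and C = ⋃ᵢ {m·a − i − 1 : m ≤ −cᵢ}.
-- With L = ℓ(λ), B contains every n < −L but not −L.  Each integer n has a
-- unique representation n + 1 = m·a − i with 0 ≤ i < a (Euclidean division),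
-- and on runner i the largest integer missing from C is −eᵢ.  Hence
--   * eᵢ ≤ L for every i: otherwise −eᵢ < −L would lie in B = C;
--   * eᵢ ≥ L for the runner i of −L, since −L ∉ B = C.

open import Defs
open import Data.Nat using (ℕ; NonZero; _∸_)
open import Data.Integer using (ℤ; +_)
open import Data.Rational using (ℚ; _+_; _*_; -_; ½; _/_)
open import Data.Fin using (Fin)
open import Relation.Binary.PropositionalEquality using (_≡_)

open import Data.Nat as ℕ using (zero; suc; z≤n; s≤s)
import Data.Nat.Properties as ℕP
open import Data.Integer as ℤ using (-[1+_])
import Data.Integer.Properties as ℤP
open import Data.Integer.DivMod using (a≡a%n+[a/n]*n; n%d<d)
open import Data.Integer.Solver using (module +-*-Solver)
open import Data.Rational as ℚ using (toℚᵘ)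
import Data.Rational.Properties as ℚP
import Data.Rational.Solver
open import Data.Rational.Unnormalised as U using (mkℚᵘ; *≡*; *≤*)
import Data.Rational.Unnormalised.Properties as UP
open import Data.Fin as Fin using (toℕ)
import Data.Fin.Properties as FinP
open import Data.List using ([]; _∷_; length)
open import Data.List.Relation.Unary.All using (All; _∷_)
open import Data.Product using (Σ; _×_; _,_)
open import Data.Empty using (⊥; ⊥-elim)
open import Function.Bundles using (Equivalence)
open import Relation.Nullary using (¬_; Dec; yes; no)
open import Relation.Binary using (tri<; tri≈; tri>)
open import Relation.Binary.PropositionalEquality
  using (refl; sym; trans; cong; cong₂; subst; module ≡-Reasoning)

open +-*-Solver
module ℚSolver = Data.Rational.Solver.+-*-Solver

ι : ℤ → ℚ
ι n = n / 1

toℚᵘ-/ : ∀ n k → toℚᵘ (n / suc k) U.≃ mkℚᵘ n k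
toℚᵘ-/ n k = ℚP.toℚᵘ-fromℚᵘ (mkℚᵘ n k)

ι-+ : ∀ p q → ι (p ℤ.+ q) ≡ ι p ℚ.+ ι q
ι-+ p q = ℚP.toℚᵘ-injective (UP.≃-trans (toℚᵘ-/ (p ℤ.+ q) 0) (UP.≃-trans (*≡* cross)
  (UP.≃-sym (UP.≃-trans (ℚP.toℚᵘ-homo-+ (ι p) (ι q)) (UP.+-cong (toℚᵘ-/ p 0) (toℚᵘ-/ q 0))))))
  where
  cross : (p ℤ.+ q) ℤ.* + 1 ≡ (p ℤ.* + 1 ℤ.+ q ℤ.* + 1) ℤ.* + 1
  cross = solve 2 (λ p q → (p :+ q) :* con (+ 1) := (p :* con (+ 1) :+ q :* con (+ 1)) :* con (+ 1)) refl p q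

ι-* : ∀ p q → ι (p ℤ.* q) ≡ ι p ℚ.* ι q
ι-* p q = ℚP.toℚᵘ-injective (UP.≃-trans (toℚᵘ-/ (p ℤ.* q) 0) (UP.≃-sym
  (UP.≃-trans (ℚP.toℚᵘ-homo-* (ι p) (ι q)) (UP.*-cong (toℚᵘ-/ p 0) (toℚᵘ-/ q 0)))))

ι-neg : ∀ p → ι (ℤ.- p) ≡ ℚ.- ι p
ι-neg p = ℚP.toℚᵘ-injective (UP.≃-trans (toℚᵘ-/ (ℤ.- p) 0)
  (UP.≃-sym (UP.≃-trans (ℚP.toℚᵘ-homo‿- (ι p)) (UP.-‿cong (toℚᵘ-/ p 0)))))

ι-injective : ∀ {p q} → ι p ≡ ι q → p ≡ q
ι-injective {p} {q} eq with UP.≃-trans (UP.≃-sym (toℚᵘ-/ p 0)) (UP.≃-trans (ℚP.toℚᵘ-cong eq) (toℚᵘ-/ q 0))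
... | *≡* cross = trans (sym (ℤP.*-identityʳ p)) (trans cross (ℤP.*-identityʳ q))

ι-mono-≤ : ∀ {p q} → p ℤ.≤ q → ι p ℚ.≤ ι q
ι-mono-≤ {p} {q} p≤q = ℚP.toℚᵘ-cancel-≤
  (UP.≤-respˡ-≃ (UP.≃-sym (toℚᵘ-/ p 0)) (UP.≤-respʳ-≃ (UP.≃-sym (toℚᵘ-/ q 0))
    (*≤* (ℤP.*-monoʳ-≤-nonNeg (+ 1) p≤q))))

ι-*-/ : ∀ k n → ι (+ suc k) ℚ.* (n / suc k) ≡ ι n
ι-*-/ k n = ℚP.toℚᵘ-injective (UP.≃-trans (ℚP.toℚᵘ-homo-* (ι (+ suc k)) (n / suc k))
  (UP.≃-trans (UP.*-cong (toℚᵘ-/ (+ suc k) 0) (toℚᵘ-/ n k)) (UP.≃-trans (*≡* cross) (UP.≃-sym (toℚᵘ-/ n 0)))))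
  where
  cross : (+ suc k ℤ.* n) ℤ.* + 1 ≡ n ℤ.* + suc (k ℕ.+ 0)
  cross rewrite ℕP.+-identityʳ k = solve 2 (λ a n → (a :* n) :* con (+ 1) := n :* a) refl (+ suc k) n

+½-injective : ∀ {p q} → ι p ℚ.+ ½ ≡ ι q ℚ.+ ½ → p ≡ q
+½-injective {p} {q} eq = ι-injective (begin
  ι p                ≡⟨ ℚSolver.solve 2 (λ x h → x ℚSolver.:= (x ℚSolver.:+ h) ℚSolver.:- h) refl (ι p) ½ ⟩
  (ι p ℚ.+ ½) ℚ.- ½  ≡⟨ cong (ℚ._- ½) eq ⟩
  (ι q ℚ.+ ½) ℚ.- ½  ≡⟨ ℚSolver.solve 2 (λ x h → (x ℚSolver.:+ h) ℚSolver.:- h ℚSolver.:= x) refl (ι q) ½ ⟩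
  ι q                ∎)
  where open ≡-Reasoning

−½≡pred+½ : ∀ q → ι q ℚ.- ½ ≡ ι (q ℤ.- + 1) ℚ.+ ½
−½≡pred+½ q = begin
  ι q ℚ.- ½                    ≡⟨⟩
  ι q ℚ.+ (ι (ℤ.- + 1) ℚ.+ ½)  ≡⟨ sym (ℚP.+-assoc (ι q) _ ½) ⟩
  (ι q ℚ.+ ι (ℤ.- + 1)) ℚ.+ ½  ≡⟨ cong (ℚ._+ ½) (sym (ι-+ q (ℤ.- + 1))) ⟩
  ι (q ℤ.- + 1) ℚ.+ ½          ∎
  where open ≡-Reasoning

+½≡−½⇒suc : ∀ {n q} → ι n ℚ.+ ½ ≡ ι q ℚ.- ½ → n ℤ.+ + 1 ≡ q
+½≡−½⇒suc {n} {q} eq = trans (cong (ℤ._+ + 1) (+½-injective {n} {q ℤ.- + 1} (trans eq (−½≡pred+½ q))))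
  (solve 1 (λ q → (q :- con (+ 1)) :+ con (+ 1) := q) refl q)

suc⇒+½≡−½ : ∀ {n q} → n ℤ.+ + 1 ≡ q → ι n ℚ.+ ½ ≡ ι q ℚ.- ½
suc⇒+½≡−½ {n} refl = trans (cong (λ m → ι m ℚ.+ ½) (solve 1 (λ n → n := (n :+ con (+ 1)) :- con (+ 1)) refl n))
  (sym (−½≡pred+½ (n ℤ.+ + 1)))

maxℚ-upper : ∀ {a} .{{_ : NonZero a}} (f : Fin a → ℚ) i → f i ℚ.≤ maxℚ f
maxℚ-upper {suc zero}    f Fin.zero    = ℚP.≤-refl
maxℚ-upper {suc (suc n)} f Fin.zero    = ℚP.p≤p⊔q (f Fin.zero) _
maxℚ-upper {suc (suc n)} f (Fin.suc i) = ℚP.p≤q⇒p≤r⊔q (f Fin.zero) (maxℚ-upper {suc n} (λ i → f (Fin.suc i)) i)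

maxℚ-least : ∀ {a} .{{_ : NonZero a}} (f : Fin a → ℚ) r → (∀ i → f i ℚ.≤ r) → maxℚ f ℚ.≤ r
maxℚ-least {suc zero}    f r f≤r = f≤r Fin.zero
maxℚ-least {suc (suc n)} f r f≤r =
  ℚP.⊔-lub (f≤r Fin.zero) (maxℚ-least {suc n} (λ i → f (Fin.suc i)) r (λ i → f≤r (Fin.suc i)))

maxℚ-attained : ∀ {a} .{{_ : NonZero a}} (f : Fin a → ℚ) r →
  (∀ i → f i ℚ.≤ r) → Σ (Fin a) (λ j → r ℚ.≤ f j) → maxℚ f ≡ r
maxℚ-attained f r f≤r (j , r≤fj) = ℚP.≤-antisym (maxℚ-least f r f≤r) (ℚP.≤-trans r≤fj (maxℚ-upper f j))

maxℚ-mono : ∀ {a} .{{_ : NonZero a}} {φ : ℚ → ℚ} → (∀ {p q} → p ℚ.< q → φ p ℚ.< φ q) →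
  (f : Fin a → ℚ) → φ (maxℚ f) ≡ maxℚ (λ i → φ (f i))
maxℚ-mono {suc zero}    φ-mono f = refl
maxℚ-mono {suc (suc n)} {φ} φ-mono f = trans (ℚP.mono-<-distrib-⊔ φ-mono (f Fin.zero) _)
  (cong (φ (f Fin.zero) ℚ.⊔_) (maxℚ-mono {suc n} φ-mono (λ i → f (Fin.suc i))))

Beta : Partition → ℤ → Set
Beta λp n = Σ ℕ λ j → (1 ℕ.≤ j) × (n ≡ + (λp ⟨ j ⟩) ℤ.- + j)

inBetaSet⇒beta : ∀ λp n → InBetaSet λp (ι n ℚ.+ ½) → Beta λp n
inBetaSet⇒beta λp n (j , 1≤j , eq) = j , 1≤j , +½-injective eq

beta⇒inBetaSet : ∀ λp n → Beta λp n → InBetaSet λp (ι n ℚ.+ ½)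
beta⇒inBetaSet λp n (j , 1≤j , eq) = j , 1≤j , cong (λ m → ι m ℚ.+ ½) eq

partAt-beyond : ∀ ps j → length ps ℕ.< j → partAt ps j ≡ 0
partAt-beyond []       j             _         = refl
partAt-beyond (p ∷ ps) (suc (suc j)) (s≤s ℓ<j) = partAt-beyond ps (suc j) ℓ<j

partAt-positive : ∀ λp j → 1 ℕ.≤ j → j ℕ.≤ ℓ λp → 1 ℕ.≤ λp ⟨ j ⟩
partAt-positive λp = go (parts λp) (positive λp)
  where
  go : ∀ ps → All (1 ℕ.≤_) ps → ∀ j → 1 ℕ.≤ j → j ℕ.≤ length ps → 1 ℕ.≤ partAt ps j
  go (p ∷ ps) (1≤p ∷ _)   (suc zero)    _ _         = 1≤p
  go (p ∷ ps) (_ ∷ 1≤ps)  (suc (suc j)) _ (s≤s j≤ℓ) = go ps 1≤ps (suc j) (s≤s z≤n) j≤ℓ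

-- Below −ℓ(λ) every integer belongs to the beta set (λⱼ = 0 for j > ℓ) ...
beta-below : ∀ λp n → n ℤ.< ℤ.- + ℓ λp → Beta λp n
beta-below λp (+ n)     n<-ℓ = ⊥-elim (ℤP.<⇒≱ n<-ℓ (ℤP.≤-trans (ℤP.neg-mono-≤ (ℤ.+≤+ z≤n)) (ℤ.+≤+ z≤n)))
beta-below λp -[1+ j ] n<-ℓ = suc j , s≤s z≤n , sym beyond
  where
  ℓ<1+j : ℓ λp ℕ.< suc j
  ℓ<1+j = ℤP.drop‿+<+ (ℤP.neg-cancel-< n<-ℓ)
  beyond : + (λp ⟨ suc j ⟩) ℤ.- + suc j ≡ -[1+ j ]
  beyond rewrite partAt-beyond (parts λp) (suc j) ℓ<1+j = refl

-- ... but −ℓ(λ) itself does not: λⱼ − j = −ℓ is impossible both for j ≤ ℓ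
-- (where λⱼ ≥ 1) and for j > ℓ (where λⱼ = 0).
beta-gap : ∀ λp → ¬ Beta λp (ℤ.- + ℓ λp)
beta-gap λp (j , 1≤j , eq) = impossible (j ℕ.≤? L)
  where
  L : ℕ
  L = ℓ λp
  λⱼ+L≡j : λp ⟨ j ⟩ ℕ.+ L ≡ j
  λⱼ+L≡j = ℤP.+-injective (begin
    + (λp ⟨ j ⟩ ℕ.+ L)                               ≡⟨ solve 3 (λ l j L → l :+ L := j :+ ((l :- j) :- (:- L))) refl (+ λp ⟨ j ⟩) (+ j) (+ L) ⟩
    + j ℤ.+ ((+ λp ⟨ j ⟩ ℤ.- + j) ℤ.- (ℤ.- + L))     ≡⟨ cong (λ x → + j ℤ.+ (x ℤ.- (ℤ.- + L))) (sym eq) ⟩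
    + j ℤ.+ ((ℤ.- + L) ℤ.- (ℤ.- + L))                ≡⟨ solve 2 (λ j x → j :+ (x :- x) := j) refl (+ j) (ℤ.- + L) ⟩
    + j                                              ∎)
    where open ≡-Reasoning
  impossible : Dec (j ℕ.≤ L) → ⊥
  impossible (yes j≤L) = ℕP.<-irrefl (sym λⱼ+L≡j)
    (ℕP.≤-trans (s≤s j≤L) (ℕP.+-monoˡ-≤ L (partAt-positive λp j 1≤j j≤L)))
  impossible (no j≰L)  = ℕP.<⇒≢ (ℕP.≰⇒> j≰L)
    (trans (cong (ℕ._+ L) (sym (partAt-beyond (parts λp) j (ℕP.≰⇒> j≰L)))) λⱼ+L≡j)

euclid : ∀ a .{{_ : NonZero a}} z → Σ ℤ λ m → Σ (Fin a) λ i → z ≡ m ℤ.* + a ℤ.- + toℕ i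
euclid a z = ℤ.- q , Fin.fromℕ< r<a , (begin
  z                            ≡⟨ sym (ℤP.neg-involutive z) ⟩
  ℤ.- (ℤ.- z)                  ≡⟨ cong ℤ.-_ (a≡a%n+[a/n]*n (ℤ.- z) (+ a)) ⟩
  ℤ.- (+ r ℤ.+ q ℤ.* + a)      ≡⟨ solve 3 (λ r q a → :- (r :+ q :* a) := (:- q) :* a :- r) refl (+ r) q (+ a) ⟩
  ℤ.- q ℤ.* + a ℤ.- + r        ≡⟨ cong (λ i → ℤ.- q ℤ.* + a ℤ.- + i) (sym (FinP.toℕ-fromℕ< r<a)) ⟩
  ℤ.- q ℤ.* + a ℤ.- + toℕ (Fin.fromℕ< r<a) ∎)
  where
  open ≡-Reasoning
  r : ℕ
  r = (ℤ.- z) ℤ.% + a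
  q : ℤ
  q = (ℤ.- z) ℤ./ + a
  r<a : r ℕ.< a
  r<a = n%d<d (ℤ.- z) (+ a)

quotient-mono : ∀ a {m m'} i {i'} → m ℤ.< m' → i' ℕ.< a → m ℤ.* + a ℤ.- + i ℤ.< m' ℤ.* + a ℤ.- + i'
quotient-mono a {m} {m'} i {i'} m<m' i'<a = begin-strict
  m ℤ.* + a ℤ.- + i                  ≤⟨ ℤP.i-j≤i (m ℤ.* + a) (+ i) ⟩
  m ℤ.* + a                          ≡⟨ solve 2 (λ m a → m :* a := (m :* a :+ a) :- a) refl m (+ a) ⟩
  (m ℤ.* + a ℤ.+ + a) ℤ.- + a        <⟨ ℤP.+-monoʳ-< (m ℤ.* + a ℤ.+ + a) (ℤP.neg-mono-< (ℤ.+<+ i'<a)) ⟩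
  (m ℤ.* + a ℤ.+ + a) ℤ.- + i'       ≡⟨ solve 3 (λ m a i → (m :* a :+ a) :- i := (con (+ 1) :+ m) :* a :- i) refl m (+ a) (+ i') ⟩
  ℤ.suc m ℤ.* + a ℤ.- + i'           ≤⟨ ℤP.+-monoˡ-≤ (ℤ.- + i') (ℤP.*-monoʳ-≤-nonNeg (+ a) (ℤP.i<j⇒suc[i]≤j m<m')) ⟩
  m' ℤ.* + a ℤ.- + i'                ∎
  where open ℤP.≤-Reasoning

euclid-unique : ∀ a {m m'} {i i' : Fin a} → m ℤ.* + a ℤ.- + toℕ i ≡ m' ℤ.* + a ℤ.- + toℕ i' → m ≡ m' × i ≡ i'
euclid-unique a {m} {m'} {i} {i'} eq with ℤP.<-cmp m m'
... | tri< m<m' _ _ = ⊥-elim (ℤP.<-irrefl eq (quotient-mono a (toℕ i) m<m' (FinP.toℕ<n i')))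
... | tri> _ _ m>m' = ⊥-elim (ℤP.<-irrefl (sym eq) (quotient-mono a (toℕ i') m>m' (FinP.toℕ<n i)))
... | tri≈ _ refl _ = refl , FinP.toℕ-injective (ℤP.+-injective (begin
  + toℕ i                                     ≡⟨ solve 2 (λ x i → i := x :- (x :- i)) refl (m ℤ.* + a) (+ toℕ i) ⟩
  m ℤ.* + a ℤ.- (m ℤ.* + a ℤ.- + toℕ i)       ≡⟨ cong (λ y → m ℤ.* + a ℤ.- y) eq ⟩
  m ℤ.* + a ℤ.- (m ℤ.* + a ℤ.- + toℕ i')      ≡⟨ solve 2 (λ x i → x :- (x :- i) := i) refl (m ℤ.* + a) (+ toℕ i') ⟩
  + toℕ i'                                    ∎))
  where open ≡-Reasoning

-- eᵢ = a·cᵢ + i − (a − 1) for a = k + 1; −eᵢ is the largest integer of the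
-- form m·a − i − 1 that is not in the core set.
e : ∀ k → (Fin (suc k) → ℤ) → Fin (suc k) → ℤ
e k c i = + suc k ℤ.* c i ℤ.+ + toℕ i ℤ.- + k

-- y ↦ −(a−1)/2 + a·y, the map applied to max xᵢ in the theorem.
affine : ℕ → ℚ → ℚ
affine k y = ℚ.- (½ ℚ.* ι (+ k)) ℚ.+ ι (+ suc k) ℚ.* y

affine-increasing : ∀ k {p q} → p ℚ.< q → affine k p ℚ.< affine k q
affine-increasing k p<q =
  ℚP.+-monoʳ-< (ℚ.- (½ ℚ.* ι (+ k))) (ℚP.*-monoʳ-<-pos (ι (+ suc k)) {{ℚP.normalize-pos (suc k) 1}} p<q)

affine-x : ∀ k c i → affine k (xVec (suc k) c i) ≡ ι (e k c i)
affine-x k c i = begin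
  ℚ.- (½ ℚ.* K) ℚ.+ A ℚ.* (C ℚ.+ (T/a ℚ.- ½ ℚ.* (K/a)))
    ≡⟨ ℚSolver.solve 6 (λ h K A C Q R → (ℚSolver.:- (h ℚSolver.:* K)) ℚSolver.:+ (A ℚSolver.:* (C ℚSolver.:+ (Q ℚSolver.:- (h ℚSolver.:* R))))
          ℚSolver.:= ((A ℚSolver.:* C ℚSolver.:+ A ℚSolver.:* Q) ℚSolver.:- h ℚSolver.:* K) ℚSolver.:- h ℚSolver.:* (A ℚSolver.:* R)) refl ½ K A C T/a K/a ⟩
  ((A ℚ.* C ℚ.+ A ℚ.* T/a) ℚ.- ½ ℚ.* K) ℚ.- ½ ℚ.* (A ℚ.* K/a)
    ≡⟨ cong₂ (λ u v → ((A ℚ.* C ℚ.+ u) ℚ.- ½ ℚ.* K) ℚ.- ½ ℚ.* v) (ι-*-/ k (+ toℕ i)) (ι-*-/ k (+ k)) ⟩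
  ((A ℚ.* C ℚ.+ T) ℚ.- ½ ℚ.* K) ℚ.- ½ ℚ.* K
    ≡⟨ ℚSolver.solve 5 (λ h K A C T → ((A ℚSolver.:* C ℚSolver.:+ T) ℚSolver.:- h ℚSolver.:* K) ℚSolver.:- h ℚSolver.:* K
          ℚSolver.:= (A ℚSolver.:* C ℚSolver.:+ T) ℚSolver.:- (h ℚSolver.:+ h) ℚSolver.:* K) refl ½ K A C T ⟩
  (A ℚ.* C ℚ.+ T) ℚ.- (½ ℚ.+ ½) ℚ.* K
    ≡⟨ cong (λ y → (A ℚ.* C ℚ.+ T) ℚ.- y) (ℚP.*-identityˡ K) ⟩
  (A ℚ.* C ℚ.+ T) ℚ.- K
    ≡⟨ sym (cong₂ (λ u v → (u ℚ.+ T) ℚ.+ v) (ι-* (+ suc k) (c i)) (ι-neg (+ k))) ⟩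
  (ι (+ suc k ℤ.* c i) ℚ.+ T) ℚ.+ ι (ℤ.- + k)
    ≡⟨ sym (trans (ι-+ (+ suc k ℤ.* c i ℤ.+ + toℕ i) (ℤ.- + k)) (cong (ℚ._+ ι (ℤ.- + k)) (ι-+ (+ suc k ℤ.* c i) (+ toℕ i)))) ⟩
  ι (e k c i) ∎
  where
  open ≡-Reasoning
  K A C T T/a K/a : ℚ
  K = ι (+ k)
  A = ι (+ suc k)
  C = ι (c i)
  T = ι (+ toℕ i)
  T/a = (+ toℕ i) / suc k
  K/a = (+ k) / suc k

module LengthOfCore (k : ℕ) (c : Fin (suc k) → ℤ) (λp : Partition) (isCore : IsCore (suc k) c λp) where

  A : ℤ
  A = + suc k

  L : ℕ
  L = ℓ λp

  -- The core set shifted by ½: integers n with n + 1 = m·a − i and m ≤ −cᵢ.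
  CoreSet : ℤ → Set
  CoreSet n = Σ (Fin (suc k)) λ i → Σ ℤ λ m → (m ℤ.≤ ℤ.- c i) × (n ℤ.+ + 1 ≡ m ℤ.* A ℤ.- + toℕ i)

  beta⇒coreSet : ∀ n → Beta λp n → CoreSet n
  beta⇒coreSet n β with Equivalence.to (isCore (ι n ℚ.+ ½)) (beta⇒inBetaSet λp n β)
  ... | i , m , m≤-cᵢ , eq = i , m , m≤-cᵢ , +½≡−½⇒suc {n} eq

  coreSet⇒beta : ∀ n → CoreSet n → Beta λp n
  coreSet⇒beta n (i , m , m≤-cᵢ , eq) =
    inBetaSet⇒beta λp n (Equivalence.from (isCore (ι n ℚ.+ ½)) (i , m , m≤-cᵢ , suc⇒+½≡−½ {n} eq))

  −e-representation : ∀ i → ℤ.- e k c i ℤ.+ + 1 ≡ (+ 1 ℤ.- c i) ℤ.* A ℤ.- + toℕ i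
  −e-representation i = solve 3 (λ K c t → :- ((con (+ 1) :+ K) :* c :+ t :- K) :+ con (+ 1)
    := (con (+ 1) :- c) :* (con (+ 1) :+ K) :- t) refl (+ k) (c i) (+ toℕ i)

  e-via-quotient : ∀ i m → ℤ.- + L ℤ.+ + 1 ≡ m ℤ.* A ℤ.- + toℕ i →
    e k c i ≡ + L ℤ.+ A ℤ.* (m ℤ.- (+ 1 ℤ.- c i))
  e-via-quotient i m eq = begin
    e k c i
      ≡⟨ solve 5 (λ K c t L m → (con (+ 1) :+ K) :* c :+ t :- K
           := (L :+ (con (+ 1) :+ K) :* (m :- (con (+ 1) :- c))) :- ((m :* (con (+ 1) :+ K) :- t) :- (:- L :+ con (+ 1))))
           refl (+ k) (c i) (+ toℕ i) (+ L) m ⟩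
    (+ L ℤ.+ A ℤ.* (m ℤ.- (+ 1 ℤ.- c i))) ℤ.- ((m ℤ.* A ℤ.- + toℕ i) ℤ.- (ℤ.- + L ℤ.+ + 1))
      ≡⟨ cong (λ x → (+ L ℤ.+ A ℤ.* (m ℤ.- (+ 1 ℤ.- c i))) ℤ.- (x ℤ.- (ℤ.- + L ℤ.+ + 1))) (sym eq) ⟩
    (+ L ℤ.+ A ℤ.* (m ℤ.- (+ 1 ℤ.- c i))) ℤ.- ((ℤ.- + L ℤ.+ + 1) ℤ.- (ℤ.- + L ℤ.+ + 1))
      ≡⟨ solve 2 (λ y z → y :- (z :- z) := y) refl (+ L ℤ.+ A ℤ.* (m ℤ.- (+ 1 ℤ.- c i))) (ℤ.- + L ℤ.+ + 1) ⟩
    + L ℤ.+ A ℤ.* (m ℤ.- (+ 1 ℤ.- c i)) ∎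
    where open ≡-Reasoning

  excess-nonNeg : ∀ i m → ¬ (m ℤ.≤ ℤ.- c i) → + 0 ℤ.≤ A ℤ.* (m ℤ.- (+ 1 ℤ.- c i))
  excess-nonNeg i m m≰-cᵢ = ℤP.≤-trans (ℤP.≤-reflexive (sym (ℤP.*-zeroʳ A)))
    (ℤP.*-monoˡ-≤-nonNeg A (ℤP.i≤j⇒0≤j-i (ℤP.i<j⇒suc[i]≤j (ℤP.≰⇒> m≰-cᵢ))))

  -- Every eᵢ is at most L: otherwise −eᵢ < −L is in B = C, and by uniqueness
  -- of its representation its quotient 1 − cᵢ would be ≤ −cᵢ.
  e-bounded : ∀ i → e k c i ℤ.≤ + L
  e-bounded i = ℤP.≮⇒≥ λ L<eᵢ → contradiction (beta⇒coreSet (ℤ.- e k c i) (beta-below λp _ (ℤP.neg-mono-< L<eᵢ)))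
    where
    contradiction : ¬ CoreSet (ℤ.- e k c i)
    contradiction (i' , m , m≤-cᵢ' , eq) with euclid-unique (suc k) {+ 1 ℤ.- c i} {m} {i} {i'} (trans (sym (−e-representation i)) eq)
    ... | refl , refl = ℤP.<-irrefl refl (ℤP.suc[i]≤j⇒i<j m≤-cᵢ')

  -- Some eᵢ is at least L: on the runner i of −L, the quotient m exceeds −cᵢ
  -- since −L ∉ B = C.
  e-attains : Σ (Fin (suc k)) λ i → + L ℤ.≤ e k c i
  e-attains with euclid (suc k) (ℤ.- + L ℤ.+ + 1)
  ... | m , i , eq with m ℤ.≤? ℤ.- c i
  ...   | yes m≤-cᵢ = ⊥-elim (beta-gap λp (coreSet⇒beta (ℤ.- + L) (i , m , m≤-cᵢ , eq)))
  ...   | no  m≰-cᵢ = i , subst (+ L ℤ.≤_) (sym (e-via-quotient i m eq))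
          (ℤP.i≤i+j (+ L) _ {{ℤ.nonNegative (excess-nonNeg i m m≰-cᵢ)}})

-- Transport ℓ = maxᵢ eᵢ along the increasing affine map sending xᵢ to eᵢ.
mainTheorem7 : (a : ℕ) → .{{_ : NonZero a}} → (c : Fin a → ℤ) → sumℤ c ≡ + 0 →
    (λp : Partition) → IsCore a c λp →
    ((+ ℓ λp) / 1) ≡ (- (½ * ((+ (a ∸ 1)) / 1))) + (((+ a) / 1) * maxℚ (xVec a c))
mainTheorem7 (suc k) c _ λp isCore = begin
  ι (+ L)                               ≡⟨ sym (maxℚ-attained (λ i → affine k (x i)) (ι (+ L)) bounded attained) ⟩
  maxℚ (λ i → affine k (x i))           ≡⟨ sym (maxℚ-mono (affine-increasing k) x) ⟩
  affine k (maxℚ x)                     ∎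
  where
  open LengthOfCore k c λp isCore
  open ≡-Reasoning
  x : Fin (suc k) → ℚ
  x = xVec (suc k) c
  bounded : ∀ i → affine k (x i) ℚ.≤ ι (+ L)
  bounded i = subst (ℚ._≤ ι (+ L)) (sym (affine-x k c i)) (ι-mono-≤ (e-bounded i))
  attained : Σ (Fin (suc k)) λ j → ι (+ L) ℚ.≤ affine k (x j)
  attained with e-attains
  ... | j , L≤eⱼ = j , subst (ι (+ L) ℚ.≤_) (sym (affine-x k c j)) (ι-mono-≤ L≤eⱼ)
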